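{- Let $G$ be a finite simple graph with $|G|$ vertices and maximum degree $\Delta(G)$. If $\frac{2}{3}|G|-2>\Delta(G)\geq \frac{1}{2}|G|$, then $a_{eq}(G)\leq \left\lceil\frac{\Delta(G)+1}{2}\right\rceil$.
   Context: All graphs are finite, undirected, without loops or multiple edges; $|G|$ denotes the number of vertices of $G$. A graph $G$ admits an equitable $k$-tree-coloring if $V(G)$ can be partitioned into $k$ subsets, each of size $\lceil |G|/k\rceil$ or $\lfloor |G|/k\rfloor$, such that each subset induces a forest in $G$. The equitable vertex arboricity $a_{eq}(G)$ is the minimum integer $k$ such that $G$ has an equitable $k$-tree-coloring. -}

module Defs where

open import Data.Nat using (ℕ; zero; suc; _+_; _*_; _≤_; _<_; _⊔_; _/_)
open import Data.Nat.DivMod using ()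
open import Data.Fin using (Fin; zero; suc)
open import Data.Bool using (Bool; true; false; if_then_else_)
open import Data.List using (List; []; _∷_; _++_; [_]; length)
open import Data.List.Relation.Unary.All using (All)
open import Data.List.Relation.Unary.Linked using (Linked)
open import Data.List.Relation.Unary.Unique.Propositional using (Unique)
open import Data.Product using (Σ; _×_; ∃-syntax)
open import Data.Sum using (_⊎_)
open import Data.Empty using (⊥)
open import Relation.Binary.PropositionalEquality using (_≡_)
open import Relation.Nullary using (¬_)
open import Data.Fin using (_≟_)
open import Relation.Nullary.Decidable using (⌊_⌋)

record Graph (n : ℕ) : Set where
  field
    adj     : Fin n → Fin n → Bool
    symm    : ∀ u v → adj u v ≡ adj v u
    irrefl  : ∀ v → adj v v ≡ false

open Graph public

order : ∀ {n} → Graph n → ℕ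
order {n} _ = n

count : ∀ {n} → (Fin n → Bool) → ℕ
count {zero}  p = 0
count {suc n} p = (if p zero then 1 else 0) + count (λ i → p (suc i))

-- maximum of a function over Fin n (0 for n = 0)
maxFin : ∀ {n} → (Fin n → ℕ) → ℕ
maxFin {zero}  f = 0
maxFin {suc n} f = f zero ⊔ maxFin (λ i → f (suc i))

degree : ∀ {n} → Graph n → Fin n → ℕ
degree G v = count (adj G v)

Δ : ∀ {n} → Graph n → ℕ
Δ G = maxFin (degree G)

Adj : ∀ {n} → Graph n → Fin n → Fin n → Set
Adj G u v = adj G u v ≡ true

-- A cycle of G: a list v₀ v₁ … v_{m-1} of m ≥ 3 distinct vertices with
-- v_i ~ v_{i+1} and v_{m-1} ~ v₀.
IsCycle : ∀ {n} → Graph n → List (Fin n) → Set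
IsCycle G []       = ⊥
IsCycle G (v ∷ vs) =
  (2 ≤ length vs) × Unique (v ∷ vs) × Linked (Adj G) ((v ∷ vs) ++ [ v ])

-- the subgraph induced by S (a predicate on vertices) is a forest:
-- there is no cycle of G all of whose vertices lie in S
InducesForest : ∀ {n} → Graph n → (Fin n → Set) → Set
InducesForest G S = ∀ cyc → All S cyc → ¬ IsCycle G cyc

-- an equitable k-tree-coloring: a partition of V(G) into k (labelled)
-- classes, each of size ⌈|G|/k⌉ or ⌊|G|/k⌋, each inducing a forest.
-- (k = 0 is never allowed; irrelevant since |G| > 12 below.)
EquitableTreeColoring : ∀ {n} → Graph n → ℕ → Set
EquitableTreeColoring {n} G zero    = ⊥
EquitableTreeColoring {n} G (suc j) =
  Σ (Fin n → Fin (suc j)) λ c →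
    ∀ (i : Fin (suc j)) →
      let size = count (λ v → ⌊ c v ≟ i ⌋) in
      ((size ≡ n / suc j) ⊎ (size ≡ (n + j) / suc j))
      × InducesForest G (λ v → c v ≡ i)

-- a_eq(G) ≤ m  :⟺  G has an equitable k-tree-coloring for some k ≤ m
-- (a_eq is the least such k, so this is exactly "a_eq(G) ≤ m").
aeq≤ : ∀ {n} → Graph n → ℕ → Set
aeq≤ G m = ∃[ k ] (k ≤ m × EquitableTreeColoring G k)

module Submission where

-- Put k = ⌈(Δ + 1)/2⌉. The hypotheses say exactly 3k < |G| < 4k, so |G| = 3k + r with 0 < r < k, and an
-- equitable k-tree-colouring has r classes of size 4 and k - r of size 3. Every vertex has at least
-- |G| - 1 - Δ ≥ k + r non-neighbours, so a greedy augmenting argument gives k + r disjoint non-adjacent pairs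
-- {a_i, b_i}. Call pair j compatible with pair i when a_i is non-adjacent to a_j or b_j; since a_i has at most
-- 2k - 1 neighbours, fewer than k pairs are incompatible with it, and the same argument matches r pairs with
-- compatible partners. Each matched couple of pairs forms a class of size 4, and each remaining pair together
-- with one of the k - r unused vertices a class of size 3. Every class can be ordered so that each vertex has
-- at most one neighbour after it, hence induces a forest.

open import Defs
open import Data.Bool using (Bool; true; false; not; _∧_; _∨_; if_then_else_)
open import Data.Bool.Properties using (∧-zeroʳ; ∧-identityʳ)
open import Data.Empty using (⊥-elim)
open import Data.Fin using (Fin; zero; suc; _≟_)
open import Data.List using (List; []; _∷_; _++_; [_]; length; map; lookup; concat; zipWith)
open import Data.List.Properties using (map-++; map-∘; map-cong; length-++; length-map; length-zipWith; concat-++; ++-assoc)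
open import Data.List.Membership.Propositional using (_∈_; find)
open import Data.List.Membership.Propositional.Properties using (∈-∃++; ∈-lookup)
open import Data.List.Relation.Binary.Permutation.Propositional as Perm
  using (_↭_; ↭-refl; ↭-trans; prep; swap)
import Data.List.Relation.Binary.Permutation.Propositional.Properties as ↭
open import Data.List.Relation.Unary.All as All using (All; []; _∷_)
import Data.List.Relation.Unary.All.Properties as All
open import Data.List.Relation.Unary.Any using (Any; here; there)
open import Data.List.Relation.Unary.Linked using (Linked; []; [-]; _∷_)
open import Data.List.Relation.Unary.Unique.Propositional using (Unique)
open import Data.List.Relation.Unary.AllPairs using (_∷_)
import Data.List.Relation.Binary.Permutation.Setoid.Properties as ↭ₛ
open import Data.Unit using (⊤; tt)
open import Data.Nat using (ℕ; zero; suc; _+_; _*_; _∸_; _/_; _⊓_; _≤_; _<_; z≤n; s≤s; _≤?_; ⌊_/2⌋; ⌈_/2⌉; NonZero)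
open import Data.Nat.DivMod using (/-congˡ; +-distrib-/-∣ˡ; m*n/n≡m; m<n⇒m/n≡0)
open import Data.Nat.Divisibility using (n∣m*n)
open import Data.Nat.Properties hiding (_≟_; ≡ᵇ⇒≡)
open import Data.Nat.ListAction using (sum)
open import Data.Nat.ListAction.Properties using (sum-++; sum-↭)
open import Algebra.Properties.CommutativeSemigroup +-commutativeSemigroup using (interchange)
open import Data.Nat.Tactic.RingSolver using (solve-∀)
open import Data.Product as Product using (_×_; _,_; proj₁; proj₂; ∃; ∃₂)
open import Data.Sum using (_⊎_; inj₁; inj₂)
open import Function using (_∘_)
open import Relation.Binary.PropositionalEquality hiding ([_])
open import Relation.Nullary using (¬_; yes; no; does)
open import Relation.Nullary.Decidable using (⌊_⌋; dec-true; dec-false; isYes≗does)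

ind : Bool → ℕ
ind b = if b then 1 else 0

∧-trueˡ : ∀ {a b} → (a ∧ b) ≡ true → a ≡ true
∧-trueˡ {true} _ = refl

∧-trueʳ : ∀ {a b} → (a ∧ b) ≡ true → b ≡ true
∧-trueʳ {true} b≡true = b≡true

not-true : ∀ {b} → not b ≡ true → b ≡ false
not-true {false} _ = refl

not-∨ : ∀ x y → not (x ∨ y) ≡ not x ∧ not y
not-∨ true  _ = refl
not-∨ false _ = refl

not-∧ : ∀ x y → not (x ∧ y) ≡ not x ∨ not y
not-∧ true  _ = refl
not-∧ false _ = refl

ind-∧-twice : ∀ x y → ind (x ∧ y) + ind (x ∧ y) ≤ ind x + ind y
ind-∧-twice true  true  = ≤-refl
ind-∧-twice true  false = z≤n
ind-∧-twice false _     = z≤n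

three-of-four : ∀ a b c d → 3 ≤ ind a + ind b + (ind c + ind d) → (a ≡ true × d ≡ true) ⊎ (b ≡ true × c ≡ true)
three-of-four true  _     _     true  _ = inj₁ (refl , refl)
three-of-four _     true  true  _     _ = inj₂ (refl , refl)
three-of-four false false false false ()
three-of-four false false false true  (s≤s ())
three-of-four false false true  false (s≤s ())
three-of-four false false true  true  (s≤s (s≤s ()))
three-of-four false true  false false (s≤s ())
three-of-four false true  false true  (s≤s (s≤s ()))
three-of-four true  false false false (s≤s ())
three-of-four true  false true  false (s≤s (s≤s ()))
three-of-four true  true  false false (s≤s (s≤s ()))

_≡ᵇ_ : ∀ {n} → Fin n → Fin n → Bool
u ≡ᵇ v = does (u ≟ v)

≡ᵇ-refl : ∀ {n} (u : Fin n) → (u ≡ᵇ u) ≡ true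
≡ᵇ-refl u = dec-true (u ≟ u) refl

≢⇒≡ᵇ-false : ∀ {n} {u v : Fin n} → u ≢ v → (u ≡ᵇ v) ≡ false
≢⇒≡ᵇ-false {u = u} {v} = dec-false (u ≟ v)

≡ᵇ⇒≡ : ∀ {n} {u v : Fin n} → (u ≡ᵇ v) ≡ true → u ≡ v
≡ᵇ⇒≡ {u = u} {v} e with yes u≡v ← u ≟ v = u≡v

≡ᵇ-false⇒≢ : ∀ {n} {u v : Fin n} → (u ≡ᵇ v) ≡ false → u ≢ v
≡ᵇ-false⇒≢ {u = u} e refl with () ← trans (sym (≡ᵇ-refl u)) e

≡ᵇ-sym : ∀ {n} (u v : Fin n) → (u ≡ᵇ v) ≡ (v ≡ᵇ u)
≡ᵇ-sym u v with u ≟ v | v ≟ u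
... | yes _   | yes _   = refl
... | no _    | no _    = refl
... | yes u≡v | no v≢u  = ⊥-elim (v≢u (sym u≡v))
... | no u≢v  | yes v≡u = ⊥-elim (u≢v (sym v≡u))

∑ : ∀ {n} → (Fin n → ℕ) → ℕ
∑ {zero}  f = 0
∑ {suc n} f = f zero + ∑ (f ∘ suc)

∑-cong : ∀ {n} {f g : Fin n → ℕ} → (∀ i → f i ≡ g i) → ∑ f ≡ ∑ g
∑-cong {zero}  f≡g = refl
∑-cong {suc n} f≡g = cong₂ _+_ (f≡g zero) (∑-cong (f≡g ∘ suc))

∑-mono-≤ : ∀ {n} {f g : Fin n → ℕ} → (∀ i → f i ≤ g i) → ∑ f ≤ ∑ g
∑-mono-≤ {zero}  f≤g = z≤n
∑-mono-≤ {suc n} f≤g = +-mono-≤ (f≤g zero) (∑-mono-≤ (f≤g ∘ suc))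

∑-distrib-+ : ∀ {n} (f g : Fin n → ℕ) → ∑ (λ i → f i + g i) ≡ ∑ f + ∑ g
∑-distrib-+ {zero}  f g = refl
∑-distrib-+ {suc n} f g =
  trans (cong (f zero + g zero +_) (∑-distrib-+ (f ∘ suc) (g ∘ suc))) (interchange (f zero) (g zero) _ _)

∑-const-0 : ∀ n → ∑ {n} (λ _ → 0) ≡ 0
∑-const-0 zero    = refl
∑-const-0 (suc n) = ∑-const-0 n

∑-const-1 : ∀ n → ∑ {n} (λ _ → 1) ≡ n
∑-const-1 zero    = refl
∑-const-1 (suc n) = cong suc (∑-const-1 n)

∑-δ : ∀ {n} (x : Fin n) (g : Fin n → ℕ) → ∑ (λ v → ind (v ≡ᵇ x) * g v) ≡ g x
∑-δ {suc n} zero    g = trans (cong₂ _+_ (+-identityʳ (g zero)) (∑-const-0 n)) (+-identityʳ (g zero))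
∑-δ {suc n} (suc x) g = ∑-δ x (g ∘ suc)

term≤∑ : ∀ {n} (f : Fin n → ℕ) i → f i ≤ ∑ f
term≤∑ f zero    = m≤m+n (f zero) _
term≤∑ f (suc i) = ≤-trans (term≤∑ (f ∘ suc) i) (m≤n+m _ (f zero))

two-terms≤∑ : ∀ {n} (f : Fin n → ℕ) {i j} → i ≢ j → f i + f j ≤ ∑ f
two-terms≤∑ f {zero}  {zero}  i≢j = ⊥-elim (i≢j refl)
two-terms≤∑ f {zero}  {suc j} _   = +-monoʳ-≤ (f zero) (term≤∑ (f ∘ suc) j)
two-terms≤∑ f {suc i} {zero}  _   = subst (_≤ ∑ f) (+-comm (f zero) (f (suc i))) (+-monoʳ-≤ (f zero) (term≤∑ (f ∘ suc) i))
two-terms≤∑ f {suc i} {suc j} i≢j = ≤-trans (two-terms≤∑ (f ∘ suc) (i≢j ∘ cong suc)) (m≤n+m _ (f zero))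

∑-positive : ∀ {n} (f : Fin n → ℕ) → 1 ≤ ∑ f → ∃ λ i → 1 ≤ f i
∑-positive {suc n} f 1≤∑ with f zero in eq
... | suc _ = zero , subst (1 ≤_) (sym eq) (s≤s z≤n)
... | zero  with i , 1≤fi ← ∑-positive (f ∘ suc) 1≤∑ = suc i , 1≤fi

term≤maxFin : ∀ {n} (f : Fin n → ℕ) i → f i ≤ maxFin f
term≤maxFin f zero    = m≤m⊔n (f zero) _
term≤maxFin f (suc i) = ≤-trans (term≤maxFin (f ∘ suc) i) (m≤n⊔m (f zero) _)

count≡∑ : ∀ {n} (p : Fin n → Bool) → count p ≡ ∑ (ind ∘ p)
count≡∑ {zero}  p = refl
count≡∑ {suc n} p = cong (ind (p zero) +_) (count≡∑ (p ∘ suc))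

count-cong : ∀ {n} {p q : Fin n → Bool} → (∀ v → p v ≡ q v) → count p ≡ count q
count-cong {p = p} {q} p≡q = trans (count≡∑ p) (trans (∑-cong (cong ind ∘ p≡q)) (sym (count≡∑ q)))

count-mono : ∀ {n} {p q : Fin n → Bool} → (∀ v → p v ≡ true → q v ≡ true) → count p ≤ count q
count-mono {p = p} {q} p⇒q = subst₂ _≤_ (sym (count≡∑ p)) (sym (count≡∑ q)) (∑-mono-≤ ind-mono)
  where
  ind-mono : ∀ v → ind (p v) ≤ ind (q v)
  ind-mono v with p v | p⇒q v
  ... | false | _    = z≤n
  ... | true  | p⇒qv rewrite p⇒qv refl = ≤-refl

count-+ : ∀ {n} (p q : Fin n → Bool) → count p + count q ≡ ∑ (λ v → ind (p v) + ind (q v))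
count-+ p q = trans (cong₂ _+_ (count≡∑ p) (count≡∑ q)) (sym (∑-distrib-+ (ind ∘ p) (ind ∘ q)))

count-pointwise : ∀ {n} (p q r : Fin n → Bool) → (∀ v → ind (p v) ≡ ind (q v) + ind (r v)) → count p ≡ count q + count r
count-pointwise p q r eq = trans (count≡∑ p) (trans (∑-cong eq) (sym (count-+ q r)))

count-split : ∀ {n} (p q : Fin n → Bool) → count p ≡ count (λ v → p v ∧ q v) + count (λ v → p v ∧ not (q v))
count-split p q = count-pointwise p _ _ split
  where
  split : ∀ v → ind (p v) ≡ ind (p v ∧ q v) + ind (p v ∧ not (q v))
  split v with p v | q v
  ... | true  | true  = refl
  ... | true  | false = refl
  ... | false | _     = refl

count-complement : ∀ {n} (p : Fin n → Bool) → count (not ∘ p) + count p ≡ n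
count-complement {n} p =
  trans (sym (count-pointwise (λ _ → true) (not ∘ p) p complement)) (trans (count≡∑ {n} (λ _ → true)) (∑-const-1 n))
  where
  complement : ∀ v → 1 ≡ ind (not (p v)) + ind (p v)
  complement v with p v
  ... | true  = refl
  ... | false = refl

count-∨ : ∀ {n} (p q : Fin n → Bool) → count (λ v → p v ∨ q v) ≤ count p + count q
count-∨ p q = subst₂ _≤_ (sym (count≡∑ (λ v → p v ∨ q v))) (sym (count-+ p q)) (∑-mono-≤ ind-∨)
  where
  ind-∨ : ∀ v → ind (p v ∨ q v) ≤ ind (p v) + ind (q v)
  ind-∨ v with p v | q v
  ... | true  | _     = s≤s z≤n
  ... | false | true  = s≤s z≤n
  ... | false | false = z≤n

count-≡ᵇ : ∀ {n} (x : Fin n) → count (_≡ᵇ x) ≡ 1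
count-≡ᵇ x = trans (count≡∑ (_≡ᵇ x)) (trans (∑-cong {f = ind ∘ (_≡ᵇ x)} (λ v → sym (*-identityʳ _))) (∑-δ x (λ _ → 1)))

count-≢ : ∀ {n} (x : Fin n) → count (λ v → not (v ≡ᵇ x)) + 1 ≡ n
count-≢ x = trans (cong (count (λ v → not (v ≡ᵇ x)) +_) (sym (count-≡ᵇ x))) (count-complement (_≡ᵇ x))

count-positive : ∀ {n} (p : Fin n → Bool) → 1 ≤ count p → ∃ λ v → p v ≡ true
count-positive {suc n} p 1≤c with p zero in eq
... | true  = zero , eq
... | false with v , pv ← count-positive (p ∘ suc) 1≤c = suc v , pv

count-two : ∀ {n} (p : Fin n → Bool) → 2 ≤ count p → ∃₂ λ u v → u ≢ v × p u ≡ true × p v ≡ true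
count-two p 2≤c =
  let u , pu = count-positive p (≤-trans (s≤s z≤n) 2≤c)
      v , pv∧v≢u = count-positive (λ v → p v ∧ not (v ≡ᵇ u)) (others u)
  in u , v , (λ u≡v → ≡ᵇ-false⇒≢ (not-true (∧-trueʳ pv∧v≢u)) (sym u≡v)) , pu , ∧-trueˡ pv∧v≢u
  where
  others : ∀ u → 1 ≤ count (λ v → p v ∧ not (v ≡ᵇ u))
  others u = +-cancelˡ-≤ 1 1 _ (≤-trans 2≤c (≤-trans (≤-reflexive (count-split p (_≡ᵇ u)))
               (+-monoˡ-≤ _ (≤-trans (count-mono (λ v → ∧-trueʳ {p v})) (≤-reflexive (count-≡ᵇ u))))))

sum-map-++ : ∀ {A : Set} (f : A → ℕ) xs ys → sum (map f (xs ++ ys)) ≡ sum (map f xs) + sum (map f ys)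
sum-map-++ f xs ys = trans (cong sum (map-++ f xs ys)) (sum-++ (map f xs) (map f ys))

sum-map-+ : ∀ {A : Set} (f g : A → ℕ) xs → sum (map (λ x → f x + g x) xs) ≡ sum (map f xs) + sum (map g xs)
sum-map-+ f g []       = refl
sum-map-+ f g (x ∷ xs) = trans (cong (f x + g x +_) (sum-map-+ f g xs)) (interchange (f x) (g x) _ _)

sum-map-const-1 : ∀ {A : Set} (xs : List A) → sum (map (λ _ → 1) xs) ≡ length xs
sum-map-const-1 []       = refl
sum-map-const-1 (x ∷ xs) = cong suc (sum-map-const-1 xs)

sum-lookup : ∀ {A : Set} (f : A → ℕ) (xs : List A) → sum (map f xs) ≡ ∑ (f ∘ lookup xs)
sum-lookup f []       = refl
sum-lookup f (x ∷ xs) = cong (f x +_) (sum-lookup f xs)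

pigeonhole : ∀ {A : Set} (g : A → ℕ) (xs : List A) → 2 * length xs < sum (map g xs) → Any (λ x → 3 ≤ g x) xs
pigeonhole g (x ∷ xs) 2n<∑ with 3 ≤? g x
... | yes 3≤gx = here 3≤gx
... | no  3≰gx = there (pigeonhole g xs (+-cancelˡ-≤ 2 _ _ (begin
  2 + suc (2 * length xs)    ≡⟨ cong suc (*-suc 2 (length xs)) ⟨
  suc (2 * suc (length xs))  ≤⟨ 2n<∑ ⟩
  g x + sum (map g xs)       ≤⟨ +-monoˡ-≤ _ (≤-pred (≰⇒> 3≰gx)) ⟩
  2 + sum (map g xs)         ∎)))
  where open ≤-Reasoning

All-zipWith : ∀ {A B C : Set} {P : C → Set} (f : A → B → C) → (∀ x y → P (f x y)) → ∀ xs ys → All P (zipWith f xs ys)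
All-zipWith f P-f []       _        = []
All-zipWith f P-f (x ∷ xs) []       = []
All-zipWith f P-f (x ∷ xs) (y ∷ ys) = P-f x y ∷ All-zipWith f P-f xs ys

occ : ∀ {n} → Fin n → List (Fin n) → ℕ
occ v xs = sum (map (λ x → ind (v ≡ᵇ x)) xs)

Distinct : ∀ {n} → List (Fin n) → Set
Distinct xs = ∀ v → occ v xs ≤ 1

_∈ᵇ_ : ∀ {n} → Fin n → List (Fin n) → Bool
v ∈ᵇ []       = false
v ∈ᵇ (x ∷ xs) = (v ≡ᵇ x) ∨ (v ∈ᵇ xs)

occ-++ : ∀ {n} (v : Fin n) xs ys → occ v (xs ++ ys) ≡ occ v xs + occ v ys
occ-++ v = sum-map-++ (λ x → ind (v ≡ᵇ x))

occ-↭ : ∀ {n} (v : Fin n) {xs ys} → xs ↭ ys → occ v xs ≡ occ v ys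
occ-↭ v xs↭ys = sum-↭ (↭.map⁺ _ xs↭ys)

Distinct-↭ : ∀ {n} {xs ys : List (Fin n)} → xs ↭ ys → Distinct xs → Distinct ys
Distinct-↭ xs↭ys d v = subst (_≤ 1) (occ-↭ v xs↭ys) (d v)

∉ᵇ⇒occ≡0 : ∀ {n} (v : Fin n) xs → (v ∈ᵇ xs) ≡ false → occ v xs ≡ 0
∉ᵇ⇒occ≡0 v []       _ = refl
∉ᵇ⇒occ≡0 v (x ∷ xs) v∉ with v ≡ᵇ x
... | false = ∉ᵇ⇒occ≡0 v xs v∉

∈ᵇ⇒occ≥1 : ∀ {n} (v : Fin n) xs → (v ∈ᵇ xs) ≡ true → 1 ≤ occ v xs
∈ᵇ⇒occ≥1 v (x ∷ xs) v∈ with v ≡ᵇ x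
... | true  = s≤s z≤n
... | false = ∈ᵇ⇒occ≥1 v xs v∈

occ≥1⇒∈ᵇ : ∀ {n} (v : Fin n) xs → 1 ≤ occ v xs → (v ∈ᵇ xs) ≡ true
occ≥1⇒∈ᵇ v xs 1≤occ with v ∈ᵇ xs in eq
... | true  = refl
... | false with () ← subst (1 ≤_) (∉ᵇ⇒occ≡0 v xs eq) 1≤occ

ind-∈ᵇ : ∀ {n} (v : Fin n) xs → occ v xs ≤ 1 → ind (v ∈ᵇ xs) ≡ occ v xs
ind-∈ᵇ v xs occ≤1 with v ∈ᵇ xs in eq
... | false = sym (∉ᵇ⇒occ≡0 v xs eq)
... | true  = ≤-antisym (∈ᵇ⇒occ≥1 v xs eq) occ≤1

∈ᵇ⇒∈ : ∀ {n} {v : Fin n} xs → (v ∈ᵇ xs) ≡ true → v ∈ xs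
∈ᵇ⇒∈ {v = v} (x ∷ xs) v∈ with v ≡ᵇ x in eq
... | true  = here (≡ᵇ⇒≡ eq)
... | false = there (∈ᵇ⇒∈ xs v∈)

∑-occ : ∀ {n} (xs : List (Fin n)) (g : Fin n → ℕ) → ∑ (λ v → occ v xs * g v) ≡ sum (map g xs)
∑-occ {n} []       g = ∑-const-0 n
∑-occ     (x ∷ xs) g = begin
  ∑ (λ v → (ind (v ≡ᵇ x) + occ v xs) * g v)              ≡⟨ ∑-cong (λ v → *-distribʳ-+ (g v) (ind (v ≡ᵇ x)) (occ v xs)) ⟩
  ∑ (λ v → ind (v ≡ᵇ x) * g v + occ v xs * g v)         ≡⟨ ∑-distrib-+ (λ v → ind (v ≡ᵇ x) * g v) (λ v → occ v xs * g v) ⟩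
  ∑ (λ v → ind (v ≡ᵇ x) * g v) + ∑ (λ v → occ v xs * g v) ≡⟨ cong₂ _+_ (∑-δ x g) (∑-occ xs g) ⟩
  g x + sum (map g xs)                                  ∎
  where open ≡-Reasoning

count-∧-∈ᵇ : ∀ {n} (f : Fin n → Bool) (xs : List (Fin n)) → Distinct xs →
             count (λ v → f v ∧ (v ∈ᵇ xs)) ≡ sum (map (ind ∘ f) xs)
count-∧-∈ᵇ f xs d = trans (count≡∑ (λ v → f v ∧ (v ∈ᵇ xs))) (trans (∑-cong ind≡occ*ind) (∑-occ xs (ind ∘ f)))
  where
  ind≡occ*ind : ∀ v → ind (f v ∧ (v ∈ᵇ xs)) ≡ occ v xs * ind (f v)
  ind≡occ*ind v with f v
  ... | true  = trans (ind-∈ᵇ v xs (d v)) (sym (*-identityʳ _))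
  ... | false = sym (*-zeroʳ (occ v xs))

count-∈ᵇ : ∀ {n} (xs : List (Fin n)) → Distinct xs → count (_∈ᵇ xs) ≡ length xs
count-∈ᵇ xs d = trans (count-∧-∈ᵇ (λ _ → true) xs d) (sum-map-const-1 xs)

length≡∑occ : ∀ {n} (xs : List (Fin n)) → length xs ≡ ∑ (λ v → occ v xs)
length≡∑occ xs = trans (sym (sum-map-const-1 xs)) (trans (sym (∑-occ xs (λ _ → 1))) (∑-cong (λ v → *-identityʳ (occ v xs))))

Distinct-∷∷ : ∀ {n} {a b : Fin n} {xs} → Distinct xs → (a ∈ᵇ xs) ≡ false → (b ∈ᵇ xs) ≡ false → a ≢ b →
              Distinct (a ∷ b ∷ xs)
Distinct-∷∷ {a = a} {b} {xs} d a∉ b∉ a≢b w with w ≡ᵇ a in w≡a | w ≡ᵇ b in w≡b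
... | true  | true  = ⊥-elim (a≢b (trans (sym (≡ᵇ⇒≡ {u = w} w≡a)) (≡ᵇ⇒≡ {u = w} w≡b)))
... | true  | false = subst (λ z → suc (occ z xs) ≤ 1) (sym (≡ᵇ⇒≡ {u = w} w≡a)) (≤-reflexive (cong suc (∉ᵇ⇒occ≡0 a xs a∉)))
... | false | true  = subst (λ z → suc (occ z xs) ≤ 1) (sym (≡ᵇ⇒≡ {u = w} w≡b)) (≤-reflexive (cong suc (∉ᵇ⇒occ≡0 b xs b∉)))
... | false | false = d w

elements : ∀ {n} → (Fin n → Bool) → List (Fin n)
elements {zero}  p = []
elements {suc n} p = if p zero then zero ∷ map suc (elements (p ∘ suc)) else map suc (elements (p ∘ suc))

occ-map-suc : ∀ {n} (v : Fin n) xs → occ (suc v) (map suc xs) ≡ occ v xs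
occ-map-suc v []       = refl
occ-map-suc v (x ∷ xs) = cong (ind (v ≡ᵇ x) +_) (occ-map-suc v xs)

occ-zero-map-suc : ∀ {n} (xs : List (Fin n)) → occ zero (map suc xs) ≡ 0
occ-zero-map-suc []       = refl
occ-zero-map-suc (x ∷ xs) = occ-zero-map-suc xs

occ-elements : ∀ {n} (p : Fin n → Bool) v → occ v (elements p) ≡ ind (p v)
occ-elements {suc n} p zero    with p zero
... | true  = cong suc (occ-zero-map-suc (elements (p ∘ suc)))
... | false = occ-zero-map-suc (elements (p ∘ suc))
occ-elements {suc n} p (suc v) with p zero
... | true  = trans (occ-map-suc v (elements (p ∘ suc))) (occ-elements (p ∘ suc) v)
... | false = trans (occ-map-suc v (elements (p ∘ suc))) (occ-elements (p ∘ suc) v)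

length-elements : ∀ {n} (p : Fin n → Bool) → length (elements p) ≡ count p
length-elements p = trans (length≡∑occ (elements p)) (trans (∑-cong (occ-elements p)) (sym (count≡∑ p)))

complement : ∀ {n} → List (Fin n) → List (Fin n)
complement xs = elements (λ v → not (v ∈ᵇ xs))

occ-++-complement : ∀ {n} (xs : List (Fin n)) → Distinct xs → ∀ v → occ v (xs ++ complement xs) ≡ 1
occ-++-complement xs d v = begin
  occ v (xs ++ complement xs)           ≡⟨ occ-++ v xs (complement xs) ⟩
  occ v xs + occ v (complement xs)      ≡⟨ cong₂ _+_ (ind-∈ᵇ v xs (d v)) (sym (occ-elements _ v)) ⟨
  ind (v ∈ᵇ xs) + ind (not (v ∈ᵇ xs))   ≡⟨ ind+ind-not (v ∈ᵇ xs) ⟩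
  1                                     ∎
  where
  open ≡-Reasoning
  ind+ind-not : ∀ b → ind b + ind (not b) ≡ 1
  ind+ind-not true  = refl
  ind+ind-not false = refl

length-complement : ∀ {n} (xs : List (Fin n)) → Distinct xs → length (complement xs) + length xs ≡ n
length-complement xs d =
  trans (cong₂ _+_ (length-elements (λ v → not (v ∈ᵇ xs))) (sym (count-∈ᵇ xs d))) (count-complement (_∈ᵇ xs))

occ-concat : ∀ {n} (v : Fin n) xss → occ v (concat xss) ≡ sum (map (occ v) xss)
occ-concat v []         = refl
occ-concat v (xs ∷ xss) = trans (occ-++ v xs (concat xss)) (cong (occ v xs +_) (occ-concat v xss))

occ-concat-map : ∀ {n} {B : Set} (v : Fin n) (f : B → List (Fin n)) xs → occ v (concat (map f xs)) ≡ sum (map (occ v ∘ f) xs)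
occ-concat-map v f xs = trans (occ-concat v (map f xs)) (cong sum (sym (map-∘ xs)))

∈⇒occ≥1 : ∀ {n} {v : Fin n} {xs} → v ∈ xs → 1 ≤ occ v xs
∈⇒occ≥1 {v = v} (here refl) rewrite ≡ᵇ-refl v = s≤s z≤n
∈⇒occ≥1 {xs = x ∷ _} (there v∈) = ≤-trans (∈⇒occ≥1 v∈) (m≤n+m _ _)

sum-map-enumeration : ∀ {m} (g : Fin m → ℕ) xs → (∀ l → occ l xs ≡ 1) → sum (map g xs) ≡ ∑ g
sum-map-enumeration g xs once = trans (sym (∑-occ xs g)) (∑-cong (λ l → trans (cong (_* g l) (once l)) (+-identityʳ (g l))))

occ-concat-zipWith : ∀ {n} {B : Set} (v : Fin n) (f : B → List (Fin n)) xs ys → length xs ≡ length ys →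
                     occ v (concat (zipWith (λ x w → f x ++ [ w ]) xs ys)) ≡ sum (map (occ v ∘ f) xs) + occ v ys
occ-concat-zipWith v f []       []       _   = refl
occ-concat-zipWith v f (x ∷ xs) (w ∷ ws) len = begin
  occ v ((f x ++ [ w ]) ++ concat (zipWith _ xs ws))       ≡⟨ occ-++ v (f x ++ [ w ]) _ ⟩
  occ v (f x ++ [ w ]) + occ v (concat (zipWith _ xs ws))  ≡⟨ cong₂ _+_ (occ-++ v (f x) [ w ])
                                                                     (occ-concat-zipWith v f xs ws (suc-injective len)) ⟩
  occ v (f x) + occ v [ w ] + (∑f + occ v ws)             ≡⟨ interchange (occ v (f x)) (occ v [ w ]) ∑f (occ v ws) ⟩
  occ v (f x) + ∑f + (occ v [ w ] + occ v ws)             ≡⟨ cong (λ o → occ v (f x) + ∑f + (o + occ v ws)) (+-identityʳ _) ⟩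
  occ v (f x) + ∑f + occ v (w ∷ ws)                       ∎
  where
  open ≡-Reasoning
  ∑f = sum (map (occ v ∘ f) xs)

ends : ∀ {A : Set} → A × A → List A
ends (a , b) = a ∷ b ∷ []

flat : ∀ {A : Set} → List (A × A) → List A
flat []             = []
flat ((a , b) ∷ ps) = a ∷ b ∷ flat ps

flat≡concat-map-ends : ∀ {A : Set} (ps : List (A × A)) → flat ps ≡ concat (map ends ps)
flat≡concat-map-ends []             = refl
flat≡concat-map-ends ((a , b) ∷ ps) = cong (λ xs → a ∷ b ∷ xs) (flat≡concat-map-ends ps)

length-flat : ∀ {A : Set} (ps : List (A × A)) → length (flat ps) ≡ 2 * length ps
length-flat []             = refl
length-flat ((a , b) ∷ ps) = trans (cong (2 +_) (length-flat ps)) (sym (*-suc 2 (length ps)))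

sum-map-flat : ∀ {A : Set} (f : A → ℕ) (ps : List (A × A)) →
               sum (map f (flat ps)) ≡ sum (map (λ p → f (proj₁ p) + f (proj₂ p)) ps)
sum-map-flat f []             = refl
sum-map-flat f ((a , b) ∷ ps) = trans (cong (λ s → f a + (f b + s)) (sum-map-flat f ps)) (sym (+-assoc (f a) (f b) _))

flat-↭ : ∀ {A : Set} {ps qs : List (A × A)} → ps ↭ qs → flat ps ↭ flat qs
flat-↭ Perm.refl                     = ↭-refl
flat-↭ (prep (a , b) p)              = prep a (prep b (flat-↭ p))
flat-↭ (swap (a , b) (c , d) p)      =
  ↭-trans (↭.shifts (a ∷ b ∷ []) (c ∷ d ∷ [])) (prep c (prep d (prep a (prep b (flat-↭ p)))))
flat-↭ (Perm.trans p q)              = ↭-trans (flat-↭ p) (flat-↭ q)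

occ-flat : ∀ {n} (v : Fin n) ps → occ v (flat ps) ≡ ∑ (λ l → occ v (ends (lookup ps l)))
occ-flat v ps = trans (cong (occ v) (flat≡concat-map-ends ps)) (trans (occ-concat-map v ends ps) (sum-lookup (occ v ∘ ends) ps))

ends-disjoint : ∀ {n} {ps : List (Fin n × Fin n)} {i j v} → Distinct (flat ps) → i ≢ j →
                v ∈ ends (lookup ps i) → ¬ v ∈ ends (lookup ps j)
ends-disjoint {ps = ps} {v = v} dist i≢j v∈i v∈j
  with s≤s () ← ≤-trans (+-mono-≤ (∈⇒occ≥1 v∈i) (∈⇒occ≥1 v∈j))
                  (≤-trans (two-terms≤∑ (λ l → occ v (ends (lookup ps l))) i≢j) (subst (_≤ 1) (occ-flat v ps) (dist v)))

-- Matchings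

module _ {N : ℕ} (A : Fin N → Fin N → Bool) where

  Arc : Fin N × Fin N → Set
  Arc (x , y) = A x y ≡ true

  IsMatching : List (Fin N × Fin N) → Set
  IsMatching M = Distinct (flat M) × All Arc M

  Matching : ℕ → Set
  Matching s = ∃ λ M → length M ≡ s × IsMatching M

  free : List (Fin N × Fin N) → Fin N → Bool
  free M w = not (w ∈ᵇ flat M)

  arcs-from : Fin N → Fin N × Fin N → ℕ
  arcs-from u (x , y) = ind (A u x) + ind (A u y)

  -- Replace the edge (x , y) of M by the edges (u , p) and (v , q), where {p , q} = {x , y}.
  reroute : ∀ {M M' x y p q u v} → IsMatching M → M ↭ (x , y) ∷ M' → x ∷ y ∷ flat M' ↭ p ∷ q ∷ flat M' →
            free M u ≡ true → free M v ≡ true → u ≢ v → A u p ≡ true → A v q ≡ true → Matching (suc (length M))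
  reroute {M} {M'} {p = p} {q} {u} {v} (dist , arcs) M↭ xy↭pq fu fv u≢v aup avq =
    (u , p) ∷ (v , q) ∷ M' , cong suc (sym (↭.↭-length M↭)) ,
    Distinct-↭ perm (Distinct-∷∷ {xs = flat M} dist (not-true fu) (not-true fv) u≢v) , aup ∷ avq ∷ All.tail (↭.All-resp-↭ M↭ arcs)
    where
    perm : u ∷ v ∷ flat M ↭ u ∷ p ∷ v ∷ q ∷ flat M'
    perm = prep u (↭-trans (prep v (↭-trans (flat-↭ M↭) xy↭pq)) (swap v p ↭-refl))

  all-arcs-covered : ∀ M u → Distinct (flat M) → count (λ w → A u w ∧ free M w) ≡ 0 →
                     count (A u) ≡ sum (map (arcs-from u) M)
  all-arcs-covered M u dist none-free = begin
    count (A u)                                                                ≡⟨ count-split (A u) (_∈ᵇ flat M) ⟩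
    count (λ w → A u w ∧ (w ∈ᵇ flat M)) + count (λ w → A u w ∧ free M w)      ≡⟨ cong₂ _+_ (count-∧-∈ᵇ (A u) (flat M) dist) none-free ⟩
    sum (map (ind ∘ A u) (flat M)) + 0                                         ≡⟨ +-identityʳ _ ⟩
    sum (map (ind ∘ A u) (flat M))                                             ≡⟨ sum-map-flat (ind ∘ A u) M ⟩
    sum (map (arcs-from u) M)                                                  ∎
    where open ≡-Reasoning

  module _ (irreflexive : ∀ x → A x x ≡ false) {t : ℕ} (min-degree : ∀ v → t ≤ count (A v)) (room : 2 * t ≤ N) where

    two-free : ∀ M → Distinct (flat M) → length M < t → 2 ≤ count (free M)
    two-free M dist len<t = +-cancelʳ-≤ (2 * length M) 2 (count (free M)) (begin
      2 + 2 * length M                     ≡⟨ *-suc 2 (length M) ⟨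
      2 * suc (length M)                   ≤⟨ *-monoʳ-≤ 2 len<t ⟩
      2 * t                                ≤⟨ room ⟩
      N                                    ≡⟨ count-complement (_∈ᵇ flat M) ⟨
      count (free M) + count (_∈ᵇ flat M)  ≡⟨ cong (count (free M) +_) (trans (count-∈ᵇ (flat M) dist) (length-flat M)) ⟩
      count (free M) + 2 * length M        ∎)
      where open ≤-Reasoning

    extend : ∀ {M u} → IsMatching M → free M u ≡ true → 1 ≤ count (λ w → A u w ∧ free M w) → Matching (suc (length M))
    extend {M} {u} (dist , arcs) fu has-free
      with w , auw∧fw ← count-positive (λ w → A u w ∧ free M w) has-free =
      (u , w) ∷ M , refl ,
      Distinct-∷∷ {xs = flat M} dist (not-true fu) (not-true (∧-trueʳ {A u w} auw∧fw)) u≢w , ∧-trueˡ auw∧fw ∷ arcs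
      where
      u≢w : u ≢ w
      u≢w refl with () ← trans (sym (irreflexive u)) (∧-trueˡ auw∧fw)

    arcs-exceed : ∀ M {u v} → length M < t → t ≤ sum (map (arcs-from u) M) → t ≤ sum (map (arcs-from v) M) →
                  2 * length M < sum (map (λ e → arcs-from u e + arcs-from v e) M)
    arcs-exceed M {u} {v} len<t t≤u t≤v = begin-strict
      2 * length M                                          <⟨ *-monoʳ-< 2 len<t ⟩
      2 * t                                                 ≡⟨ cong (t +_) (+-identityʳ t) ⟩
      t + t                                                 ≤⟨ +-mono-≤ t≤u t≤v ⟩
      sum (map (arcs-from u) M) + sum (map (arcs-from v) M) ≡⟨ sum-map-+ (arcs-from u) (arcs-from v) M ⟨
      sum (map (λ e → arcs-from u e + arcs-from v e) M)     ∎
      where open ≤-Reasoning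

    -- Some edge of M receives three of the four possible arcs from u and v.
    exchange : ∀ {M u v} → IsMatching M → free M u ≡ true → free M v ≡ true → u ≢ v → length M < t →
               t ≤ sum (map (arcs-from u) M) → t ≤ sum (map (arcs-from v) M) → Matching (suc (length M))
    exchange {M} {u} {v} m fu fv u≢v len<t t≤u t≤v
      with (x , y) , e∈M , three ← find (pigeonhole _ M (arcs-exceed M len<t t≤u t≤v))
      with M₁ , M₂ , refl ← ∈-∃++ e∈M
      with three-of-four (A u x) (A u y) (A v x) (A v y) three
    ... | inj₁ (aux , avy) = reroute m (↭.shift (x , y) M₁ M₂) ↭-refl fu fv u≢v aux avy
    ... | inj₂ (auy , avx) = reroute m (↭.shift (x , y) M₁ M₂) (swap x y ↭-refl) fu fv u≢v auy avx

    extend-or-covered : ∀ M {u} → IsMatching M → free M u ≡ true →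
                        Matching (suc (length M)) ⊎ t ≤ sum (map (arcs-from u) M)
    extend-or-covered M {u} m fu with 1 ≤? count (λ w → A u w ∧ free M w)
    ... | yes has-free = inj₁ (extend m fu has-free)
    ... | no  no-free  = inj₂ (subst (t ≤_) (all-arcs-covered M u (proj₁ m) (n<1⇒n≡0 (≰⇒> no-free))) (min-degree u))

    augment : ∀ {M} → IsMatching M → length M < t →
              (∃₂ λ u v → u ≢ v × free M u ≡ true × free M v ≡ true) → Matching (suc (length M))
    augment {M} m len<t (u , v , u≢v , fu , fv) = choose (extend-or-covered M m fu) (extend-or-covered M m fv)
      where
      choose : Matching (suc (length M)) ⊎ t ≤ sum (map (arcs-from u) M) →
               Matching (suc (length M)) ⊎ t ≤ sum (map (arcs-from v) M) → Matching (suc (length M))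
      choose (inj₁ bigger) _              = bigger
      choose (inj₂ _)      (inj₁ bigger)  = bigger
      choose (inj₂ t≤u)    (inj₂ t≤v)     = exchange m fu fv u≢v len<t t≤u t≤v

    matching-upto : ∀ s → s ≤ t → Matching s
    matching-upto zero    _   = [] , refl , (λ _ → z≤n) , []
    matching-upto (suc s) s<t with M , refl , m ← matching-upto s (<⇒≤ s<t) =
      augment m s<t (count-two (free M) (two-free M (proj₁ m) s<t))

  opaque
    min-degree⇒matching : (∀ x → A x x ≡ false) → ∀ t → (∀ v → t ≤ count (A v)) → 2 * t ≤ N → Matching t
    min-degree⇒matching irreflexive t min-degree room = matching-upto irreflexive min-degree room t ≤-refl

module _ {A : Set} {R : A → A → Set} where

  Linked-split : ∀ xs {y ys} → Linked R (xs ++ y ∷ ys) → Linked R (xs ++ [ y ]) × Linked R (y ∷ ys)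
  Linked-split []            l       = [-] , l
  Linked-split (x ∷ [])      (r ∷ l) = r ∷ [-] , l
  Linked-split (x ∷ x' ∷ xs) (r ∷ l) = let l₁ , l₂ = Linked-split (x' ∷ xs) l in r ∷ l₁ , l₂

  Linked-join : ∀ xs {y ys} → Linked R (xs ++ [ y ]) → Linked R (y ∷ ys) → Linked R (xs ++ y ∷ ys)
  Linked-join []            _        l = l
  Linked-join (x ∷ [])      (r ∷ _)  l = r ∷ l
  Linked-join (x ∷ x' ∷ xs) (r ∷ l₁) l = r ∷ Linked-join (x' ∷ xs) l₁ l

  Linked-last : ∀ {w} ws {b} → Linked R ((w ∷ ws) ++ [ b ]) → ∃ λ z → z ∈ w ∷ ws × R z b
  Linked-last []       (r ∷ _) = _ , here refl , r
  Linked-last (_ ∷ ws) (_ ∷ l) = let z , z∈ , r = Linked-last ws l in z , there z∈ , r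

Unique-↭ : ∀ {A : Set} {xs ys : List A} → xs ↭ ys → Unique xs → Unique ys
Unique-↭ {A} xs↭ys = ↭ₛ.Unique-resp-↭ (setoid A) (Perm.↭⇒↭ₛ xs↭ys)

module _ {n : ℕ} (G : Graph n) where

  adj-sym : ∀ {x y} → Adj G x y → Adj G y x
  adj-sym {x} {y} = trans (symm G y x)

  adj-irrefl : ∀ {x} → ¬ Adj G x x
  adj-irrefl {x} x~x with () ← trans (sym (irrefl G x)) x~x

  TwoNeighboursIn : Fin n → List (Fin n) → Set
  TwoNeighboursIn x xs = ∃₂ λ y z → y ≢ z × y ∈ xs × z ∈ xs × Adj G x y × Adj G x z

  TwoNeighboursIn-↭ : ∀ {x xs ys} → xs ↭ ys → TwoNeighboursIn x xs → TwoNeighboursIn x ys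
  TwoNeighboursIn-↭ xs↭ys (y , z , y≢z , y∈ , z∈ , x~y , x~z) =
    y , z , y≢z , ↭.∈-resp-↭ xs↭ys y∈ , ↭.∈-resp-↭ xs↭ys z∈ , x~y , x~z

  rotate : ∀ v A x B → IsCycle G (v ∷ A ++ x ∷ B) → IsCycle G (x ∷ B ++ v ∷ A)
  rotate v A x B (2≤len , uniq , linked) =
    subst (2 ≤_) (suc-injective (↭.↭-length comm)) 2≤len , Unique-↭ comm uniq ,
    subst (Linked (Adj G)) (sym (++-assoc (x ∷ B) (v ∷ A) [ x ])) (Linked-join (x ∷ B) (proj₂ split) (proj₁ split))
    where
    comm : (v ∷ A) ++ (x ∷ B) ↭ (x ∷ B) ++ (v ∷ A)
    comm = ↭.++-comm (v ∷ A) (x ∷ B)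
    split : Linked (Adj G) ((v ∷ A) ++ [ x ]) × Linked (Adj G) (x ∷ B ++ [ v ])
    split = Linked-split (v ∷ A) (subst (Linked (Adj G)) (++-assoc (v ∷ A) (x ∷ B) [ v ]) linked)

  head-neighbours : ∀ {v vs} → IsCycle G (v ∷ vs) → TwoNeighboursIn v (v ∷ vs)
  head-neighbours {vs = _ ∷ []} (s≤s () , _)
  head-neighbours {v} {y ∷ w ∷ ws} (_ , (_ ∷ y∉ws ∷ _) , v~y ∷ _ ∷ linked)
    with z , z∈ , z~v ← Linked-last ws linked =
    y , z , All.lookup y∉ws z∈ , there (here refl) , there (there z∈) , v~y , adj-sym z~v

  cycle-neighbours : ∀ {cyc x} → IsCycle G cyc → x ∈ cyc → TwoNeighboursIn x cyc
  cycle-neighbours {v ∷ vs} c (here refl) = head-neighbours c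
  cycle-neighbours {v ∷ vs} c (there x∈vs) with A , B , refl ← ∈-∃++ x∈vs =
    TwoNeighboursIn-↭ (↭.++-comm (_ ∷ B) (v ∷ A)) (head-neighbours (rotate v A _ B c))

  Degenerate₁ : List (Fin n) → Set
  Degenerate₁ []       = ⊤
  Degenerate₁ (x ∷ xs) = (∀ {y z} → y ∈ xs → z ∈ xs → Adj G x y → Adj G x z → y ≡ z) × Degenerate₁ xs

  Degenerate₁⇒forest : ∀ B → Degenerate₁ B → InducesForest G (_∈ B)
  Degenerate₁⇒forest []      _                 []      _          ()
  Degenerate₁⇒forest []      _                 (_ ∷ _) (() ∷ _)   _
  Degenerate₁⇒forest (x ∷ B) (x-deg , B-deg)   cyc     cyc⊆xB     is-cycle =
    Degenerate₁⇒forest B B-deg cyc (All.tabulate cyc⊆B) is-cycle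
    where
    later : ∀ {y} → y ∈ cyc → Adj G x y → y ∈ B
    later y∈ x~y with All.lookup cyc⊆xB y∈
    ... | here refl = ⊥-elim (adj-irrefl x~y)
    ... | there y∈B = y∈B
    cyc⊆B : ∀ {w} → w ∈ cyc → w ∈ B
    cyc⊆B w∈ with All.lookup cyc⊆xB w∈
    ... | there w∈B = w∈B
    ... | here refl with y , z , y≢z , y∈ , z∈ , x~y , x~z ← cycle-neighbours is-cycle w∈ =
      ⊥-elim (y≢z (x-deg (later y∈ x~y) (later z∈ x~z) x~y x~z))

  Degenerate₁-∷ : ∀ {x} w {xs} → (∀ {y} → y ∈ xs → Adj G x y → y ≡ w) → Degenerate₁ xs → Degenerate₁ (x ∷ xs)
  Degenerate₁-∷ w only-w deg = (λ y∈ z∈ x~y x~z → trans (only-w y∈ x~y) (sym (only-w z∈ x~z))) , deg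

  Degenerate₁-pair : ∀ {y w} → Degenerate₁ (y ∷ w ∷ [])
  Degenerate₁-pair {w = w} = Degenerate₁-∷ w (λ { (here refl) _ → refl ; (there ()) _ }) ((λ ()) , tt)

  degenerate₃ : ∀ {x y w} → ¬ Adj G x y → Degenerate₁ (x ∷ y ∷ w ∷ [])
  degenerate₃ {w = w} x≁y = Degenerate₁-∷ w only-w Degenerate₁-pair
    where
    only-w : ∀ {z} → z ∈ _ ∷ w ∷ [] → Adj G _ z → z ≡ w
    only-w (here refl)         x~y = ⊥-elim (x≁y x~y)
    only-w (there (here refl)) _   = refl
    only-w (there (there ()))  _

  degenerate₄ : ∀ {x y p q} → ¬ Adj G x y → ¬ Adj G x p → ¬ Adj G y q → Degenerate₁ (x ∷ y ∷ p ∷ q ∷ [])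
  degenerate₄ {x} {y} {p} {q} x≁y x≁p y≁q = Degenerate₁-∷ q only-q (Degenerate₁-∷ p only-p Degenerate₁-pair)
    where
    only-q : ∀ {z} → z ∈ y ∷ p ∷ q ∷ [] → Adj G x z → z ≡ q
    only-q (here refl)                 x~y = ⊥-elim (x≁y x~y)
    only-q (there (here refl))         x~p = ⊥-elim (x≁p x~p)
    only-q (there (there (here refl))) _   = refl
    only-p : ∀ {z} → z ∈ p ∷ q ∷ [] → Adj G y z → z ≡ p
    only-p (here refl)         _   = refl
    only-p (there (here refl)) y~q = ⊥-elim (y≁q y~q)

-- Colourings from partitions into blocks

module _ {n : ℕ} (P : List (List (Fin n))) (once : ∀ v → occ v (concat P) ≡ 1) where

  ∑-occ-blocks : ∀ v → ∑ (λ i → occ v (lookup P i)) ≡ 1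
  ∑-occ-blocks v = trans (sym (trans (occ-concat v P) (sum-lookup (occ v) P))) (once v)

  block-of : Fin n → Fin (length P)
  block-of v = proj₁ (∑-positive (λ i → occ v (lookup P i)) (≤-reflexive (sym (∑-occ-blocks v))))

  in-block-of : ∀ v → 1 ≤ occ v (lookup P (block-of v))
  in-block-of v = proj₂ (∑-positive (λ i → occ v (lookup P i)) (≤-reflexive (sym (∑-occ-blocks v))))

  block-unique : ∀ {v} i j → 1 ≤ occ v (lookup P i) → 1 ≤ occ v (lookup P j) → i ≡ j
  block-unique {v} i j v∈i v∈j with i ≟ j
  ... | yes i≡j = i≡j
  ... | no  i≢j with s≤s () ← ≤-trans (+-mono-≤ v∈i v∈j)
                                (≤-trans (two-terms≤∑ (λ l → occ v (lookup P l)) i≢j) (≤-reflexive (∑-occ-blocks v)))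

  block-distinct : ∀ i → Distinct (lookup P i)
  block-distinct i v = ≤-trans (term≤∑ (λ j → occ v (lookup P j)) i) (≤-reflexive (∑-occ-blocks v))

  block-of≡ᵇ : ∀ i v → (block-of v ≡ᵇ i) ≡ (v ∈ᵇ lookup P i)
  block-of≡ᵇ i v with block-of v ≟ i
  ... | yes refl = sym (occ≥1⇒∈ᵇ v (lookup P i) (in-block-of v))
  ... | no  b≢i with v ∈ᵇ lookup P i in eq
  ...   | false = refl
  ...   | true  = ⊥-elim (b≢i (block-unique {v} (block-of v) i (in-block-of v) (∈ᵇ⇒occ≥1 v (lookup P i) eq)))

  colour-class-size : ∀ i → count (λ v → ⌊ block-of v ≟ i ⌋) ≡ length (lookup P i)
  colour-class-size i =
    trans (count-cong (λ v → trans (isYes≗does (block-of v ≟ i)) (block-of≡ᵇ i v))) (count-∈ᵇ (lookup P i) (block-distinct i))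

  colour-class⊆block : ∀ {i v} → block-of v ≡ i → v ∈ lookup P i
  colour-class⊆block {i} {v} refl = ∈ᵇ⇒∈ (lookup P i) (occ≥1⇒∈ᵇ v (lookup P i) (in-block-of v))

InducesForest-⊆ : ∀ {n} (G : Graph n) {S T : Fin n → Set} → (∀ {v} → T v → S v) → InducesForest G S → InducesForest G T
InducesForest-⊆ G T⊆S S-forest cyc cyc⊆T = S-forest cyc (All.map T⊆S cyc⊆T)

EquitableSize : ℕ → ℕ → ℕ → Set
EquitableSize n j s = (s ≡ n / suc j) ⊎ (s ≡ (n + j) / suc j)

equitable-blocks⇒coloring : ∀ {n} (G : Graph n) j (P : List (List (Fin n))) → length P ≡ suc j →
                            (∀ v → occ v (concat P) ≡ 1) →
                            All (λ B → Degenerate₁ G B × EquitableSize n j (length B)) P →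
                            EquitableTreeColoring G (suc j)
equitable-blocks⇒coloring {n} G j P@(_ ∷ P') len once good with refl ← suc-injective len =
  block-of P once , λ i →
    let deg , size = All.lookup good (∈-lookup i) in
    subst (EquitableSize n j) (sym (colour-class-size P once i)) size ,
    InducesForest-⊆ G (colour-class⊆block P once) (Degenerate₁⇒forest G (lookup P i) deg)

-- The construction

module Construction {n : ℕ} (G : Graph n) {k r : ℕ} (n≡3k+r : n ≡ 3 * k + r) (r≤k : r ≤ k)
                    (degree<2k : ∀ v → degree G v < 2 * k) where

  nonadj : Fin n → Fin n → Bool
  nonadj u v = not (adj G u v) ∧ not (v ≡ᵇ u)

  nonadj-irrefl : ∀ x → nonadj x x ≡ false
  nonadj-irrefl x rewrite ≡ᵇ-refl x = ∧-zeroʳ (not (adj G x x))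

  nonadj⇒≁ : ∀ {u v} → nonadj u v ≡ true → ¬ Adj G u v
  nonadj⇒≁ u≁v u~v with () ← trans (sym (not-true (∧-trueˡ u≁v))) u~v

  nonadj-sym : ∀ {u v} → nonadj u v ≡ true → nonadj v u ≡ true
  nonadj-sym {u} {v} u≁v rewrite symm G v u | ≡ᵇ-sym u v = u≁v

  nonadj-degree : ∀ u → k + r ≤ count (nonadj u)
  nonadj-degree u = +-cancelʳ-≤ (2 * k) (k + r) (count (nonadj u)) (begin
    k + r + 2 * k                    ≡⟨ lemma k r ⟩
    3 * k + r                        ≡⟨ n≡3k+r ⟨
    n                                ≡⟨ count-complement near ⟨
    count (not ∘ near) + count near  ≤⟨ +-mono-≤ (≤-reflexive (count-cong far≡nonadj)) near≤2k ⟩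
    count (nonadj u) + 2 * k         ∎)
    where
    open ≤-Reasoning
    lemma : ∀ k r → k + r + 2 * k ≡ 3 * k + r
    lemma = solve-∀
    near : Fin n → Bool
    near w = adj G u w ∨ (w ≡ᵇ u)
    far≡nonadj : ∀ w → not (near w) ≡ nonadj u w
    far≡nonadj w = not-∨ (adj G u w) (w ≡ᵇ u)
    near≤2k : count near ≤ 2 * k
    near≤2k = begin
      count near                  ≤⟨ count-∨ (adj G u) (_≡ᵇ u) ⟩
      degree G u + count (_≡ᵇ u)  ≡⟨ cong (degree G u +_) (count-≡ᵇ u) ⟩
      degree G u + 1              ≡⟨ +-comm (degree G u) 1 ⟩
      suc (degree G u)            ≤⟨ degree<2k u ⟩
      2 * k                       ∎

  room₁ : 2 * (k + r) ≤ n
  room₁ = begin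
    2 * (k + r)    ≡⟨ lemma k r ⟩
    2 * k + r + r  ≤⟨ +-monoʳ-≤ (2 * k + r) r≤k ⟩
    2 * k + r + k  ≡⟨ lemma′ k r ⟩
    3 * k + r      ≡⟨ n≡3k+r ⟨
    n              ∎
    where
    open ≤-Reasoning
    lemma : ∀ k r → 2 * (k + r) ≡ 2 * k + r + r
    lemma = solve-∀
    lemma′ : ∀ k r → 2 * k + r + k ≡ 3 * k + r
    lemma′ = solve-∀

  opaque
    matching₁ : Matching nonadj (k + r)
    matching₁ = min-degree⇒matching nonadj nonadj-irrefl (k + r) nonadj-degree room₁

    M₁ : List (Fin n × Fin n)
    M₁ = proj₁ matching₁

    |M₁| : length M₁ ≡ k + r
    |M₁| = proj₁ (proj₂ matching₁)

    M₁-distinct : Distinct (flat M₁)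
    M₁-distinct = proj₁ (proj₂ (proj₂ matching₁))

    M₁-arcs : All (Arc nonadj) M₁
    M₁-arcs = proj₂ (proj₂ (proj₂ matching₁))

  a b : Fin (length M₁) → Fin n
  a l = proj₁ (lookup M₁ l)
  b l = proj₂ (lookup M₁ l)

  a≁b : ∀ l → nonadj (a l) (b l) ≡ true
  a≁b l = All.lookup M₁-arcs (∈-lookup l)

  a-∉-other-edges : ∀ {i j} → j ≢ i → (a j ≡ᵇ a i) ≡ false × (b j ≡ᵇ a i) ≡ false
  a-∉-other-edges j≢i =
    ≢⇒≡ᵇ-false (λ aj≡ai → ends-disjoint {ps = M₁} M₁-distinct j≢i (here (sym aj≡ai)) (here refl)) ,
    ≢⇒≡ᵇ-false (λ bj≡ai → ends-disjoint {ps = M₁} M₁-distinct j≢i (there (here (sym bj≡ai))) (here refl))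

  compatible : Fin (length M₁) → Fin (length M₁) → Bool
  compatible i j = not (j ≡ᵇ i) ∧ (nonadj (a i) (a j) ∨ nonadj (a i) (b j))

  compatible-irrefl : ∀ i → compatible i i ≡ false
  compatible-irrefl i rewrite ≡ᵇ-refl i = refl

  compatible⇒nonadj : ∀ {i j} → compatible i j ≡ true → (nonadj (a i) (a j) ∨ nonadj (a i) (b j)) ≡ true
  compatible⇒nonadj {i} {j} = ∧-trueʳ {not (j ≡ᵇ i)}

  both-adjacent : Fin (length M₁) → Fin (length M₁) → Bool
  both-adjacent i j = adj G (a i) (a j) ∧ adj G (a i) (b j)

  both-adjacent-few : ∀ i → count (both-adjacent i) < k
  both-adjacent-few i = *-cancelˡ-< 2 (count (both-adjacent i)) k (begin-strict
    2 * count (both-adjacent i)                          ≡⟨ cong (count (both-adjacent i) +_) (+-identityʳ _) ⟩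
    count (both-adjacent i) + count (both-adjacent i)    ≡⟨ count-+ (both-adjacent i) (both-adjacent i) ⟩
    ∑ (λ j → ind (both-adjacent i j) + ind (both-adjacent i j))  ≤⟨ ∑-mono-≤ twice≤arcs ⟩
    ∑ (arcs-from (adj G) (a i) ∘ lookup M₁)              ≡⟨ sum-lookup (arcs-from (adj G) (a i)) M₁ ⟨
    sum (map (arcs-from (adj G) (a i)) M₁)               ≡⟨ sum-map-flat (ind ∘ adj G (a i)) M₁ ⟨
    sum (map (ind ∘ adj G (a i)) (flat M₁))              ≡⟨ count-∧-∈ᵇ (adj G (a i)) (flat M₁) M₁-distinct ⟨
    count (λ w → adj G (a i) w ∧ (w ∈ᵇ flat M₁))         ≤⟨ count-mono (λ w → ∧-trueˡ {adj G (a i) w}) ⟩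
    degree G (a i)                                       <⟨ degree<2k (a i) ⟩
    2 * k                                                ∎)
    where
    open ≤-Reasoning
    twice≤arcs : ∀ j → ind (both-adjacent i j) + ind (both-adjacent i j) ≤ arcs-from (adj G) (a i) (lookup M₁ j)
    twice≤arcs j = ind-∧-twice (adj G (a i) (a j)) (adj G (a i) (b j))

  nonadj-≢ : ∀ {u v} → (v ≡ᵇ u) ≡ false → nonadj u v ≡ not (adj G u v)
  nonadj-≢ {u} {v} v≢u = trans (cong (λ b → not (adj G u v) ∧ not b) v≢u) (∧-identityʳ (not (adj G u v)))

  not-both⇒compatible : ∀ i j → (not (j ≡ᵇ i) ∧ not (both-adjacent i j)) ≡ true → compatible i j ≡ true
  not-both⇒compatible i j h = begin
    not (j ≡ᵇ i) ∧ (nonadj (a i) (a j) ∨ nonadj (a i) (b j))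
      ≡⟨ cong (not (j ≡ᵇ i) ∧_) (cong₂ _∨_ (nonadj-≢ aj≢ai) (nonadj-≢ bj≢ai)) ⟩
    not (j ≡ᵇ i) ∧ (not (adj G (a i) (a j)) ∨ not (adj G (a i) (b j)))
      ≡⟨ cong (not (j ≡ᵇ i) ∧_) (not-∧ (adj G (a i) (a j)) _) ⟨
    not (j ≡ᵇ i) ∧ not (both-adjacent i j)
      ≡⟨ h ⟩
    true
      ∎
    where
    open ≡-Reasoning
    aj≢ai = proj₁ (a-∉-other-edges (≡ᵇ-false⇒≢ {u = j} (not-true (∧-trueˡ h))))
    bj≢ai = proj₂ (a-∉-other-edges (≡ᵇ-false⇒≢ {u = j} (not-true (∧-trueˡ h))))

  -- At most k - 1 of the other k + r - 1 edges are incompatible with i.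
  compatible-degree : ∀ i → r ≤ count (compatible i)
  compatible-degree i = +-cancelʳ-≤ k r (count (compatible i)) (begin
    r + k
      ≡⟨ +-comm r k ⟩
    k + r
      ≡⟨ |M₁| ⟨
    length M₁
      ≡⟨ count-≢ i ⟨
    count others + 1
      ≡⟨ cong (_+ 1) (count-split others (both-adjacent i)) ⟩
    count (λ j → others j ∧ both-adjacent i j) + count (λ j → others j ∧ not (both-adjacent i j)) + 1
      ≤⟨ +-monoˡ-≤ 1 (+-mono-≤ (count-mono (λ j → ∧-trueʳ {others j})) (count-mono (not-both⇒compatible i))) ⟩
    count (both-adjacent i) + count (compatible i) + 1
      ≡⟨ trans (+-comm _ 1) (+-comm (suc (count (both-adjacent i))) _) ⟩
    count (compatible i) + suc (count (both-adjacent i))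
      ≤⟨ +-monoʳ-≤ (count (compatible i)) (both-adjacent-few i) ⟩
    count (compatible i) + k
      ∎)
    where
    open ≤-Reasoning
    others : Fin (length M₁) → Bool
    others j = not (j ≡ᵇ i)

  room₂ : 2 * r ≤ length M₁
  room₂ = begin
    2 * r   ≡⟨ cong (r +_) (+-identityʳ r) ⟩
    r + r   ≤⟨ +-monoˡ-≤ r r≤k ⟩
    k + r   ≡⟨ |M₁| ⟨
    length M₁ ∎
    where open ≤-Reasoning

  opaque
    matching₂ : Matching compatible r
    matching₂ = min-degree⇒matching compatible compatible-irrefl r compatible-degree room₂

    M₂ : List (Fin (length M₁) × Fin (length M₁))
    M₂ = proj₁ matching₂

    |M₂| : length M₂ ≡ r
    |M₂| = proj₁ (proj₂ matching₂)

    M₂-distinct : Distinct (flat M₂)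
    M₂-distinct = proj₁ (proj₂ (proj₂ matching₂))

    M₂-arcs : All (Arc compatible) M₂
    M₂-arcs = proj₂ (proj₂ (proj₂ matching₂))

  block₄ : Fin (length M₁) × Fin (length M₁) → List (Fin n)
  block₄ (i , j) = if nonadj (a i) (a j) then a i ∷ a j ∷ b i ∷ b j ∷ [] else a i ∷ b j ∷ b i ∷ a j ∷ []

  block₃ : Fin (length M₁) → Fin n → List (Fin n)
  block₃ l w = ends (lookup M₁ l) ++ [ w ]

  unmatched : List (Fin (length M₁))
  unmatched = complement (flat M₂)

  leftover : List (Fin n)
  leftover = complement (flat M₁)

  blocks : List (List (Fin n))
  blocks = map block₄ M₂ ++ zipWith block₃ unmatched leftover

  GoodBlock : List (Fin n) → Set
  GoodBlock B = Degenerate₁ G B × (length B ≡ 3 ⊎ length B ≡ 4)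

  block₄-good : ∀ {i j} → (nonadj (a i) (a j) ∨ nonadj (a i) (b j)) ≡ true → GoodBlock (block₄ (i , j))
  block₄-good {i} {j} compatible-ij with nonadj (a i) (a j) in ai≁aj
  ... | true  = degenerate₄ G (nonadj⇒≁ ai≁aj) (nonadj⇒≁ (a≁b i)) (nonadj⇒≁ (a≁b j)) , inj₂ refl
  ... | false = degenerate₄ G (nonadj⇒≁ compatible-ij) (nonadj⇒≁ (a≁b i)) (nonadj⇒≁ (nonadj-sym (a≁b j))) , inj₂ refl

  block₃-good : ∀ l w → GoodBlock (block₃ l w)
  block₃-good l w = degenerate₃ G (nonadj⇒≁ (a≁b l)) , inj₁ refl

  blocks-good : All GoodBlock blocks
  blocks-good = All.++⁺ (All.map⁺ (All.map (block₄-good ∘ compatible⇒nonadj) M₂-arcs))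
                        (All-zipWith block₃ block₃-good unmatched leftover)

  |unmatched| : length unmatched + r ≡ k
  |unmatched| = +-cancelʳ-≡ r (length unmatched + r) k (begin
    length unmatched + r + r                  ≡⟨ +-assoc (length unmatched) r r ⟩
    length unmatched + (r + r)                ≡⟨ cong (λ m → length unmatched + (r + m)) (+-identityʳ r) ⟨
    length unmatched + 2 * r                  ≡⟨ cong (length unmatched +_) (trans (length-flat M₂) (cong (2 *_) |M₂|)) ⟨
    length unmatched + length (flat M₂)       ≡⟨ length-complement (flat M₂) M₂-distinct ⟩
    length M₁                                 ≡⟨ |M₁| ⟩
    k + r                                     ∎)
    where open ≡-Reasoning

  |leftover| : length leftover + r ≡ k
  |leftover| = +-cancelʳ-≡ (2 * k + r) (length leftover + r) k (begin
    length leftover + r + (2 * k + r)         ≡⟨ lemma (length leftover) k r ⟩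
    length leftover + 2 * (k + r)             ≡⟨ cong (length leftover +_) (trans (length-flat M₁) (cong (2 *_) |M₁|)) ⟨
    length leftover + length (flat M₁)        ≡⟨ length-complement (flat M₁) M₁-distinct ⟩
    n                                         ≡⟨ n≡3k+r ⟩
    3 * k + r                                 ≡⟨ lemma′ k r ⟩
    k + (2 * k + r)                           ∎)
    where
    open ≡-Reasoning
    lemma : ∀ l k r → l + r + (2 * k + r) ≡ l + 2 * (k + r)
    lemma = solve-∀
    lemma′ : ∀ k r → 3 * k + r ≡ k + (2 * k + r)
    lemma′ = solve-∀

  |unmatched|≡|leftover| : length unmatched ≡ length leftover
  |unmatched|≡|leftover| = +-cancelʳ-≡ r _ _ (trans |unmatched| (sym |leftover|))

  |blocks| : length blocks ≡ k
  |blocks| = begin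
    length blocks
      ≡⟨ length-++ (map block₄ M₂) ⟩
    length (map block₄ M₂) + length (zipWith block₃ unmatched leftover)
      ≡⟨ cong₂ _+_ (trans (length-map block₄ M₂) |M₂|) (length-zipWith block₃ unmatched leftover) ⟩
    r + (length unmatched ⊓ length leftover)
      ≡⟨ cong (λ m → r + (length unmatched ⊓ m)) |unmatched|≡|leftover| ⟨
    r + (length unmatched ⊓ length unmatched)
      ≡⟨ cong (r +_) (⊓-idem (length unmatched)) ⟩
    r + length unmatched
      ≡⟨ +-comm r (length unmatched) ⟩
    length unmatched + r
      ≡⟨ |unmatched| ⟩
    k
      ∎
    where open ≡-Reasoning

  occ-block₄ : ∀ v e → occ v (block₄ e) ≡ occ v (ends (lookup M₁ (proj₁ e))) + occ v (ends (lookup M₁ (proj₂ e)))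
  occ-block₄ v (i , j) with nonadj (a i) (a j)
  ... | true  = trans (occ-↭ v perm) (occ-++ v (ends (lookup M₁ i)) (ends (lookup M₁ j)))
    where
    perm : a i ∷ a j ∷ b i ∷ b j ∷ [] ↭ a i ∷ b i ∷ a j ∷ b j ∷ []
    perm = prep (a i) (swap (a j) (b i) ↭-refl)
  ... | false = trans (occ-↭ v perm) (occ-++ v (ends (lookup M₁ i)) (ends (lookup M₁ j)))
    where
    perm : a i ∷ b j ∷ b i ∷ a j ∷ [] ↭ a i ∷ b i ∷ a j ∷ b j ∷ []
    perm = prep (a i) (↭-trans (swap (b j) (b i) ↭-refl) (prep (b i) (swap (b j) (a j) ↭-refl)))

  occ-blocks : ∀ v → occ v (concat blocks) ≡ 1
  occ-blocks v = begin
    occ v (concat blocks)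
      ≡⟨ cong (occ v) (concat-++ fours threes) ⟨
    occ v (concat fours ++ concat threes)
      ≡⟨ occ-++ v (concat fours) (concat threes) ⟩
    occ v (concat fours) + occ v (concat threes)
      ≡⟨ cong₂ _+_ occ-fours occ-threes ⟩
    sum (map g (flat M₂)) + (sum (map g unmatched) + occ v leftover)
      ≡⟨ +-assoc (sum (map g (flat M₂))) _ _ ⟨
    sum (map g (flat M₂)) + sum (map g unmatched) + occ v leftover
      ≡⟨ cong (_+ occ v leftover) (sum-map-++ g (flat M₂) unmatched) ⟨
    sum (map g (flat M₂ ++ unmatched)) + occ v leftover
      ≡⟨ cong (_+ occ v leftover) (sum-map-enumeration g (flat M₂ ++ unmatched) (occ-++-complement (flat M₂) M₂-distinct)) ⟩
    ∑ g + occ v leftover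
      ≡⟨ cong (_+ occ v leftover) (occ-flat v M₁) ⟨
    occ v (flat M₁) + occ v leftover
      ≡⟨ occ-++ v (flat M₁) leftover ⟨
    occ v (flat M₁ ++ leftover)
      ≡⟨ occ-++-complement (flat M₁) M₁-distinct v ⟩
    1
      ∎
    where
    open ≡-Reasoning
    fours threes : List (List (Fin n))
    fours  = map block₄ M₂
    threes = zipWith block₃ unmatched leftover
    g : Fin (length M₁) → ℕ
    g l = occ v (ends (lookup M₁ l))
    occ-fours : occ v (concat fours) ≡ sum (map g (flat M₂))
    occ-fours = trans (occ-concat-map v block₄ M₂) (trans (cong sum (map-cong (occ-block₄ v) M₂)) (sym (sum-map-flat g M₂)))
    occ-threes : occ v (concat threes) ≡ sum (map g unmatched) + occ v leftover
    occ-threes = occ-concat-zipWith v (ends ∘ lookup M₁) unmatched leftover |unmatched|≡|leftover|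

m≤2*⌈m/2⌉ : ∀ m → m ≤ 2 * ⌈ m /2⌉
m≤2*⌈m/2⌉ m = begin
  m                  ≡⟨ ⌊n/2⌋+⌈n/2⌉≡n m ⟨
  ⌊ m /2⌋ + ⌈ m /2⌉  ≤⟨ +-monoˡ-≤ ⌈ m /2⌉ (⌊n/2⌋≤⌈n/2⌉ m) ⟩
  ⌈ m /2⌉ + ⌈ m /2⌉  ≡⟨ cong (⌈ m /2⌉ +_) (+-identityʳ _) ⟨
  2 * ⌈ m /2⌉        ∎
  where open ≤-Reasoning

2*⌊m/2⌋≤m : ∀ m → 2 * ⌊ m /2⌋ ≤ m
2*⌊m/2⌋≤m m = begin
  2 * ⌊ m /2⌋        ≡⟨ cong (⌊ m /2⌋ +_) (+-identityʳ _) ⟩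
  ⌊ m /2⌋ + ⌊ m /2⌋  ≤⟨ +-monoʳ-≤ ⌊ m /2⌋ (⌊n/2⌋≤⌈n/2⌉ m) ⟩
  ⌊ m /2⌋ + ⌈ m /2⌉  ≡⟨ ⌊n/2⌋+⌈n/2⌉≡n m ⟩
  m                  ∎
  where open ≤-Reasoning

[q*d+m]/d≡q : ∀ q {d} .{{_ : NonZero d}} {m} → m < d → (q * d + m) / d ≡ q
[q*d+m]/d≡q q {d} {m} m<d = begin
  (q * d + m) / d    ≡⟨ +-distrib-/-∣ˡ m (n∣m*n q) ⟩
  q * d / d + m / d  ≡⟨ cong₂ _+_ (m*n/n≡m q d) (m<n⇒m/n≡0 m<d) ⟩
  q + 0              ≡⟨ +-identityʳ q ⟩
  q                  ∎
  where open ≡-Reasoning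

-- With k = ⌊ D /2⌋ + 1 = ⌈ (D + 1)/2 ⌉ we have D < 2k ≤ D + 2, and the hypotheses become 3k < n < 4k.
Δ-bounds : ∀ {D n} → 3 * D + 6 < 2 * n → n ≤ 2 * D → 3 * suc ⌊ D /2⌋ < n × n < 4 * suc ⌊ D /2⌋
Δ-bounds {D} {n} 3D+6<2n n≤2D = *-cancelˡ-< 2 (3 * k) n lower , upper
  where
  k = suc ⌊ D /2⌋
  lower : 2 * (3 * k) < 2 * n
  lower = begin-strict
    2 * (3 * k)  ≡⟨ lemma k ⟩
    3 * (2 * k)  ≤⟨ *-monoʳ-≤ 3 (2*⌊m/2⌋≤m (2 + D)) ⟩
    3 * (2 + D)  ≡⟨ lemma′ D ⟩
    3 * D + 6    <⟨ 3D+6<2n ⟩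
    2 * n        ∎
    where
    open ≤-Reasoning
    lemma : ∀ k → 2 * (3 * k) ≡ 3 * (2 * k)
    lemma = solve-∀
    lemma′ : ∀ D → 3 * (2 + D) ≡ 3 * D + 6
    lemma′ = solve-∀
  upper : n < 4 * k
  upper = begin-strict
    n            ≤⟨ n≤2D ⟩
    2 * D        <⟨ *-monoʳ-< 2 (m≤2*⌈m/2⌉ (suc D)) ⟩
    2 * (2 * k)  ≡⟨ lemma k ⟩
    4 * k        ∎
    where
    open ≤-Reasoning
    lemma : ∀ k → 2 * (2 * k) ≡ 4 * k
    lemma = solve-∀

module _ {n j : ℕ} (3k<n : 3 * suc j < n) (n<4k : n < 4 * suc j) where

  surplus : ℕ
  surplus = n ∸ suc (3 * suc j)

  n≡3k+1+surplus : n ≡ 3 * suc j + suc surplus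
  n≡3k+1+surplus = sym (trans (+-suc (3 * suc j) surplus) (m+[n∸m]≡n 3k<n))

  1+surplus<k : suc surplus < suc j
  1+surplus<k = +-cancelˡ-< (3 * suc j) (suc surplus) (suc j) (begin-strict
    3 * suc j + suc surplus  ≡⟨ n≡3k+1+surplus ⟨
    n                        <⟨ n<4k ⟩
    4 * suc j                ≡⟨ lemma (suc j) ⟩
    3 * suc j + suc j        ∎)
    where
    open ≤-Reasoning
    lemma : ∀ k → 4 * k ≡ 3 * k + k
    lemma = solve-∀

  three-equitable : EquitableSize n j 3
  three-equitable = inj₁ (sym (trans (/-congˡ n≡3k+1+surplus) ([q*d+m]/d≡q 3 1+surplus<k)))

  four-equitable : EquitableSize n j 4
  four-equitable = inj₂ (sym (trans (/-congˡ (trans (cong (_+ j) n≡3k+1+surplus) (lemma j surplus)))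
                                      ([q*d+m]/d≡q 4 (<⇒≤ 1+surplus<k))))
    where
    lemma : ∀ j s → 3 * suc j + suc s + j ≡ 4 * suc j + s
    lemma = solve-∀

theorem2p6 : ∀ {n : ℕ} (G : Graph n) →
    3 * Δ G + 6 < 2 * n →
    n ≤ 2 * Δ G →
    aeq≤ G ⌈ Δ G + 1 /2⌉
theorem2p6 {n} G 3Δ+6<2n n≤2Δ =
  ⌈ Δ G + 1 /2⌉ , ≤-refl , subst (EquitableTreeColoring G) (cong ⌈_/2⌉ (+-comm 1 (Δ G))) coloring
  where
  j = ⌊ Δ G /2⌋
  3k<n : 3 * suc j < n
  3k<n = proj₁ (Δ-bounds 3Δ+6<2n n≤2Δ)
  n<4k : n < 4 * suc j
  n<4k = proj₂ (Δ-bounds 3Δ+6<2n n≤2Δ)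
  degree<2k : ∀ v → degree G v < 2 * suc j
  degree<2k v = s≤s (≤-trans (term≤maxFin (degree G) v) (≤-pred (m≤2*⌈m/2⌉ (suc (Δ G)))))
  open Construction G (n≡3k+1+surplus 3k<n n<4k) (<⇒≤ (1+surplus<k 3k<n n<4k)) degree<2k
  equitable : ∀ B → length B ≡ 3 ⊎ length B ≡ 4 → EquitableSize n j (length B)
  equitable _ (inj₁ ≡3) = subst (EquitableSize n j) (sym ≡3) (three-equitable 3k<n n<4k)
  equitable _ (inj₂ ≡4) = subst (EquitableSize n j) (sym ≡4) (four-equitable 3k<n n<4k)
  coloring : EquitableTreeColoring G (suc j)
  coloring = equitable-blocks⇒coloring G j blocks |blocks| occ-blocks (All.map (λ {B} → Product.map₂ (equitable B)) blocks-good)
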